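{- Let $\mathbb{F}_q$ be a finite field with $q\equiv 3\pmod 4$, so $q=2s+1$ with $s$ odd. For $a\in\mathbb{F}_q$ let $Q_a=\begin{pmatrix} a & 1\\ 1 & 0\end{pmatrix}$ with characteristic polynomial $x^2-ax-1$. (a) If $\gamma_1\in\mathbb{F}_q$ is a root of $x^2-ax-1$ with multiplicative order $s$, then the other root $\gamma_2$ is a Lucas primitive root. (b) There are exactly $\varphi(s)$ values of $a\in\mathbb{F}_q$ for which $x^2-ax-1$ has a Lucas primitive root; for each such $a$ there is exactly one Lucas primitive root, and the other root has order $s$. In particular, there is no $a$ for which $x^2-ax-1$ has two distinct roots that are both Lucas primitive roots.
   Context: A Lucas primitive root (LPR) for $a$ is a root of $x^2-ax-1$ in $\mathbb{F}_q$ that generates the cyclic group $\mathbb{F}_q^\times$. $\varphi$ is Euler's totient function. -}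

module Defs where

open import Level using (Level; _⊔_; suc)
open import Algebra.Bundles using (CommutativeRing)
open import Data.Nat as ℕ using (ℕ; zero; _<_; _≤_)
open import Data.Nat.GCD using (gcd)
open import Data.Fin using (Fin)
open import Data.List using (List; length; filter; map; upTo)
open import Data.Product using (Σ; ∃; _×_)
open import Relation.Nullary using (¬_)
open import Relation.Binary using (Decidable)
open import Relation.Binary.PropositionalEquality using (_≡_)

φ : ℕ → ℕ
φ n = length (filter (λ k → gcd k n ℕ.≟ 1) (map ℕ.suc (upTo n)))

record FiniteField (c ℓ : Level) : Set (Level.suc (c ⊔ ℓ)) where
  field
    commRing  : CommutativeRing c ℓ
  open CommutativeRing commRing public
  field
    0≉1       : ¬ (0# ≈ 1#)
    inverse   : ∀ x → ¬ (x ≈ 0#) → ∃ λ y → x * y ≈ 1#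
    _≈?_      : Decidable _≈_
    q         : ℕ
    enum      : Fin q → Carrier
    enum-surj : ∀ x → ∃ λ i → enum i ≈ x
    enum-inj  : ∀ i j → enum i ≈ enum j → i ≡ j

module FieldNotions {c ℓ} (F : FiniteField c ℓ) where
  open FiniteField F

  _^_ : Carrier → ℕ → Carrier
  x ^ zero = 1#
  x ^ ℕ.suc n = x * (x ^ n)

  HasOrder : Carrier → ℕ → Set ℓ
  HasOrder x n = (1 ≤ n) × ((x ^ n) ≈ 1#) × (∀ m → 1 ≤ m → m < n → ¬ ((x ^ m) ≈ 1#))

  Generates : Carrier → Set (c ⊔ ℓ)
  Generates x = ¬ (x ≈ 0#) × (∀ y → ¬ (y ≈ 0#) → ∃ λ k → (x ^ k) ≈ y)

  IsRoot : Carrier → Carrier → Set ℓ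
  IsRoot a γ = (γ * γ) + (- (a * γ)) + (- 1#) ≈ 0#

  LPR : Carrier → Carrier → Set (c ⊔ ℓ)
  LPR a γ = IsRoot a γ × Generates γ

module Submission where

-- F_q^× is cyclic of order q − 1 = 2s with s odd. The two roots of x² − a x − 1 multiply to −1, so if γ₁ has
-- order s, the other root γ₂ = −γ₁⁻¹ has order lcm(2, s) = 2s and generates F_q^×. Conversely, if γ generates,
-- then γ ^ s = −1 and the other root −γ⁻¹ = γ ^ (s − 1) = (γ ^ 2) ^ ((s − 1) / 2) has order s < 2s; so there is
-- at most one Lucas primitive root per a, and the a admitting one are exactly the traces h ^ k − h ^ (s − k) of
-- the φ(s) elements h ^ k (gcd(k, s) = 1) of order s, where h = g ^ 2 for a generator g.
-- Cyclicity of F_q^× is proved from scratch: orders can be enlarged along a prime until the order m of some x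
-- annihilates every unit, and then the m + 1 distinct roots of X ^ m − 1 that would arise from a unit outside
-- ⟨x⟩ are too many for a polynomial of degree m.

open import Defs
open import Level using (_⊔_)
open import Data.Nat as ℕ using (ℕ; zero; suc; _∸_; _%_; _/_; z≤n; s≤s; NonZero; >-nonZero; >-nonZero⁻¹; anyUpTo?)
import Data.Nat.Properties as ℕ
open import Data.Nat.DivMod using (m≡m%n+[m/n]*n; m%n<n)
open import Data.Nat.Divisibility using (_∣_; divides; ∣-refl; ∣-antisym; ∣⇒≤; n∣m*n; m∣m*n; *-cancelˡ-∣; m%n≡0⇒n∣m; *-pres-∣; quotient; m∣n⇒n≡quotient*m)
open import Data.Nat.Coprimality using (Coprime; coprime-divisor)
import Data.Nat.Coprimality as Coprime
open import Data.Nat.GCD using (gcd)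
open import Data.Fin.Base using (Fin; zero; suc; toℕ; fromℕ<)
import Data.Fin.Properties as Fin
import Data.Vec.Functional as Vector
open import Data.List using (List; []; _∷_; length; map; filter; upTo)
open import Data.List.Properties using (length-map)
open import Data.List.Relation.Unary.Any using (Any)
import Data.List.Relation.Unary.Any.Properties as Any
open import Data.List.Relation.Unary.AllPairs using (AllPairs)
import Data.List.Relation.Unary.AllPairs.Properties as AllPairs
open import Data.List.Membership.Propositional using (lose; find)
open import Data.List.Membership.Propositional.Properties using (∈-filter⁺; ∈-filter⁻; ∈-map⁺; ∈-map⁻; ∈-upTo⁺; ∈-upTo⁻)
open import Data.Product using (Σ; ∃; ∃₂; _×_; _,_; proj₁; proj₂)
open import Data.Sum using (_⊎_; inj₁; inj₂; [_,_]′)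
open import Data.Empty using (⊥; ⊥-elim)
open import Function.Base using (_∘_)
open import Function.Definitions using (Injective)
open import Relation.Nullary using (¬_; yes; no; contradiction)
open import Relation.Nullary.Decidable using (_×-dec_; ¬?; decidable-stable)
open import Relation.Binary.Definitions using (tri<; tri≈; tri>)
open import Relation.Binary.PropositionalEquality as ≡ using (_≡_)

module Arithmetic where
  open import Data.Nat.Base using (_+_; _*_; _^_; _<_; nonTrivial⇒n>1; n>1⇒nonTrivial; ≢-nonZero⁻¹)
  open import Data.Nat.Properties
    using (_≟_; m^n≢0; *-identityˡ; *-identityʳ; +-identityʳ; +-comm; *-assoc; *-comm; m*n≢0⇒m≢0; m<m*n; ≤∧≢⇒<; n≢0⇒n>0; *-commutativeSemigroup)
  open import Data.Nat.Divisibility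
  open import Data.Nat.DivMod using (+-distrib-/-∣ʳ; m*n/n≡m)
  open import Data.Nat.Solver using (module +-*-Solver)
  open import Data.Nat.Coprimality using (coprime⇒gcd≡1)
  open import Data.Nat.LCM using (lcm; lcm-least; gcd*lcm)
  open import Data.Nat.Primality using (Prime; composite?; prime; euclidsLemma; prime⇒irreducible; prime⇒nonTrivial; prime⇒nonZero)
  open import Data.Nat.Divisibility.Core using (hasNonTrivialDivisor)
  open import Data.Nat.Induction using (<-wellFounded)
  open import Induction.WellFounded using (Acc; acc)
  open import Algebra.Properties.CommutativeSemigroup *-commutativeSemigroup using (x∙yz≈y∙xz)
  open import Relation.Unary using (Decidable)
  open import Relation.Binary.PropositionalEquality using (_≢_; refl; sym; trans; cong; subst; subst₂; module ≡-Reasoning)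
  open ≡-Reasoning

  minimalWitness : ∀ {p} {P : ℕ → Set p} → Decidable P → ∀ {n} → P n →
                   ∃ λ k → P k × (∀ {j} → j < k → ¬ P j)
  minimalWitness {P = P} P? {n} = go n (<-wellFounded n)
    where
    go : ∀ n → Acc _<_ n → P n → ∃ λ k → P k × (∀ {j} → j < k → ¬ P j)
    go n (acc below) Pn with anyUpTo? P? n
    ... | yes (j , j<n , Pj) = go j (below j<n) Pj
    ... | no none            = n , Pn , λ j<n Pj → none (_ , j<n , Pj)

  prime>1 : ∀ {p} → Prime p → 1 < p
  prime>1 {p} pr = nonTrivial⇒n>1 p {{prime⇒nonTrivial pr}}

  ∃-primeDivisor : ∀ {n} → 1 < n → ∃ λ p → Prime p × p ∣ n
  ∃-primeDivisor {n} = go n (<-wellFounded n)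
    where
    go : ∀ n → Acc _<_ n → 1 < n → ∃ λ p → Prime p × p ∣ n
    go n (acc below) 1<n with composite? n
    ... | no ¬composite = n , prime {{n>1⇒nonTrivial 1<n}} ¬composite , ∣-refl
    ... | yes (hasNonTrivialDivisor {d} d<n d∣n) =
      let p , pr , p∣d = go d (below d<n) (nonTrivial⇒n>1 d) in p , pr , ∣-trans p∣d d∣n

  prime≢1 : ∀ {p} → Prime p → p ≢ 1
  prime≢1 pr refl with prime>1 pr
  ... | s≤s ()

  prime∣prime^⇒≡ : ∀ {r p} e → Prime r → Prime p → r ∣ p ^ e → r ≡ p
  prime∣prime^⇒≡ zero r-prime _ r∣1 = contradiction (∣1⇒≡1 r∣1) (prime≢1 r-prime)
  prime∣prime^⇒≡ {p = p} (suc e) r-prime p-prime r∣pᵉ⁺¹ with euclidsLemma p (p ^ e) r-prime r∣pᵉ⁺¹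
  ... | inj₂ r∣pᵉ = prime∣prime^⇒≡ e r-prime p-prime r∣pᵉ
  ... | inj₁ r∣p with prime⇒irreducible p-prime r∣p
  ...   | inj₁ r≡1 = contradiction r≡1 (prime≢1 r-prime)
  ...   | inj₂ r≡p = r≡p

  prime^-coprime : ∀ {p m} e → Prime p → ¬ p ∣ m → Coprime (p ^ e) m
  prime^-coprime {p} {m} e p-prime p∤m {i} (i∣pᵉ , i∣m) with i ≟ 1
  ... | yes i≡1 = i≡1
  ... | no i≢1 =
    let r , r-prime , r∣i = ∃-primeDivisor (≤∧≢⇒< (n≢0⇒n>0 i≢0) (i≢1 ∘ sym))
        r≡p = prime∣prime^⇒≡ e r-prime p-prime (∣-trans r∣i i∣pᵉ)
    in  contradiction (subst (_∣ m) r≡p (∣-trans r∣i i∣m)) p∤m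
    where
    i≢0 : i ≢ 0
    i≢0 refl = ≢-nonZero⁻¹ (p ^ e) {{m^n≢0 p e {{prime⇒nonZero p-prime}}}} (0∣⇒≡0 i∣pᵉ)

  coprime⇒*∣ : ∀ {a b k} → Coprime a b → a ∣ k → b ∣ k → a * b ∣ k
  coprime⇒*∣ {a} {b} a⊥b a∣k b∣k = subst (_∣ _) lcm≡a*b (lcm-least a∣k b∣k)
    where
    lcm≡a*b : lcm a b ≡ a * b
    lcm≡a*b = trans (sym (*-identityˡ (lcm a b))) (trans (cong (_* lcm a b) (sym (coprime⇒gcd≡1 a⊥b))) (gcd*lcm a b))

  record ExcessPrimePower (b m : ℕ) : Set where
    field
      p e f m′ : ℕ
      p-prime  : Prime p
      pᵉ∣b     : p ^ e ∣ b
      m≡pᶠm′   : m ≡ p ^ f * m′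
      p∤m′     : ¬ p ∣ m′
      f<e      : f < e

  excessPrimePower-*ʳ : ∀ {r b m} → Prime r → ExcessPrimePower b m → ExcessPrimePower (r * b) (r * m)
  excessPrimePower-*ʳ {r} {b} {m} r-prime x with r ≟ ExcessPrimePower.p x
  ... | yes refl = record
    { p = r ; e = suc e ; f = suc f ; m′ = m′
    ; p-prime = p-prime
    ; pᵉ∣b    = *-monoʳ-∣ r pᵉ∣b
    ; m≡pᶠm′  = trans (cong (r *_) m≡pᶠm′) (sym (*-assoc r (r ^ f) m′))
    ; p∤m′    = p∤m′
    ; f<e     = s≤s f<e
    }
    where open ExcessPrimePower x
  ... | no r≢p = record
    { p = p ; e = e ; f = f ; m′ = r * m′
    ; p-prime = p-prime
    ; pᵉ∣b    = ∣-trans pᵉ∣b (n∣m*n r)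
    ; m≡pᶠm′  = trans (cong (r *_) m≡pᶠm′) (x∙yz≈y∙xz r (p ^ f) m′)
    ; p∤m′    = p∤rm′
    ; f<e     = f<e
    }
    where
    open ExcessPrimePower x
    p∤rm′ : ¬ p ∣ r * m′
    p∤rm′ p∣rm′ with euclidsLemma r m′ p-prime p∣rm′
    ... | inj₂ p∣m′ = p∤m′ p∣m′
    ... | inj₁ p∣r with prime⇒irreducible r-prime p∣r
    ...   | inj₁ p≡1 = prime≢1 p-prime p≡1
    ...   | inj₂ p≡r = r≢p (sym p≡r)

  abstract
    excessPrimePower : ∀ {b m} .{{_ : NonZero b}} .{{_ : NonZero m}} → ¬ b ∣ m → ExcessPrimePower b m
    excessPrimePower {b} = go b (<-wellFounded b)
      where
      go : ∀ b {m} → Acc _<_ b → .{{NonZero b}} → .{{NonZero m}} → ¬ b ∣ m → ExcessPrimePower b m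
      go b {m} (acc below) b∤m with b ≟ 1
      ... | yes refl = contradiction (1∣ m) b∤m
      ... | no b≢1 with ∃-primeDivisor (≤∧≢⇒< (>-nonZero⁻¹ b) (b≢1 ∘ sym))
      ...   | p , p-prime , divides b′ refl with p ∣? m
      ...     | no p∤m = record
        { p = p ; e = 1 ; f = 0 ; m′ = m
        ; p-prime = p-prime
        ; pᵉ∣b    = subst (_∣ b′ * p) (sym (*-identityʳ p)) (n∣m*n b′)
        ; m≡pᶠm′  = sym (+-identityʳ m)
        ; p∤m′    = p∤m
        ; f<e     = s≤s z≤n
        }
      ...     | yes (divides m′ refl) =
        subst₂ ExcessPrimePower (*-comm p b′) (*-comm p m′)
          (excessPrimePower-*ʳ p-prime (go b′ (below b′<b) b′∤m′))
        where
        instance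
          b′≢0 : NonZero b′
          b′≢0 = m*n≢0⇒m≢0 b′
          m′≢0 : NonZero m′
          m′≢0 = m*n≢0⇒m≢0 m′
        b′<b : b′ < b′ * p
        b′<b = m<m*n b′ p (prime>1 p-prime)
        b′∤m′ : ¬ b′ ∣ m′
        b′∤m′ b′∣m′ = b∤m (*-monoˡ-∣ p b′∣m′)

  ∣1+m∧∣m⇒≡1 : ∀ {d m} → d ∣ suc m → d ∣ m → d ≡ 1
  ∣1+m∧∣m⇒≡1 {d} {m} d∣1+m d∣m = ∣1⇒≡1 (∣m+n∣m⇒∣n (subst (d ∣_) (+-comm 1 m) d∣1+m) d∣m)

  coprime[2,1+2t] : ∀ t → Coprime 2 (suc (t * 2))
  coprime[2,1+2t] t (d∣2 , d∣1+2t) = ∣1+m∧∣m⇒≡1 d∣1+2t (∣-trans d∣2 (n∣m*n t))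

  coprime[1+2t,t] : ∀ t → Coprime (suc (t * 2)) t
  coprime[1+2t,t] t (d∣1+2t , d∣t) = ∣1+m∧∣m⇒≡1 d∣1+2t (∣m⇒∣m*n 2 d∣t)

  ≡3mod4⇒halves : ∀ q → q % 4 ≡ 3 → q / 2 ≡ suc (q / 4 * 2) × q ≡ suc (q / 2 * 2)
  ≡3mod4⇒halves q q%4≡3 = s≡1+2t , trans q≡1+2s (cong (λ s → suc (s * 2)) (sym s≡1+2t))
    where
    open +-*-Solver
    t = q / 4
    q≡1+2s : q ≡ suc (suc (t * 2) * 2)
    q≡1+2s = begin
      q                      ≡⟨ m≡m%n+[m/n]*n q 4 ⟩
      q % 4 + t * 4          ≡⟨ cong (_+ t * 4) q%4≡3 ⟩
      3 + t * 4              ≡⟨ solve 1 (λ t → con 3 :+ t :* con 4 := con 1 :+ (con 1 :+ t :* con 2) :* con 2) refl t ⟩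
      suc (suc (t * 2) * 2)  ∎
    s≡1+2t : q / 2 ≡ suc (t * 2)
    s≡1+2t = begin
      q / 2                      ≡⟨ cong (_/ 2) q≡1+2s ⟩
      suc (suc (t * 2) * 2) / 2  ≡⟨ +-distrib-/-∣ʳ 1 {d = 2} (n∣m*n (suc (t * 2))) ⟩
      suc (t * 2) * 2 / 2        ≡⟨ m*n/n≡m (suc (t * 2)) 2 ⟩
      suc (t * 2)                ∎

open Arithmetic

module FieldArithmetic {c ℓ} (F : FiniteField c ℓ) where
  open FiniteField F
  open FieldNotions F
  open import Relation.Binary.Reasoning.Setoid setoid
  open import Algebra.Properties.Ring ring using (-‿distribˡ-*; -‿distribʳ-*)
  open import Algebra.Properties.AbelianGroup +-abelianGroup using (x∙y⁻¹≈ε⇒x≈y; identityˡ-unique; ⁻¹-involutive; ε⁻¹≈ε)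
  open import Algebra.Solver.Ring.NaturalCoefficients.Default commutativeSemiring using (solve; _:+_; _:*_; _:=_)

  *-cancelˡ : ∀ {x y z} → ¬ x ≈ 0# → x * y ≈ x * z → y ≈ z
  *-cancelˡ {x} {y} {z} x≉0 xy≈xz with inverse x x≉0
  ... | x⁻¹ , xx⁻¹≈1 = begin
    y              ≈⟨ *-identityˡ y ⟨
    1# * y         ≈⟨ *-congʳ (trans (*-comm x⁻¹ x) xx⁻¹≈1) ⟨
    x⁻¹ * x * y    ≈⟨ *-assoc x⁻¹ x y ⟩
    x⁻¹ * (x * y)  ≈⟨ *-congˡ xy≈xz ⟩
    x⁻¹ * (x * z)  ≈⟨ *-assoc x⁻¹ x z ⟨
    x⁻¹ * x * z    ≈⟨ *-congʳ (trans (*-comm x⁻¹ x) xx⁻¹≈1) ⟩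
    1# * z         ≈⟨ *-identityˡ z ⟩
    z              ∎

  *-nonzero : ∀ {x y} → ¬ x ≈ 0# → ¬ y ≈ 0# → ¬ x * y ≈ 0#
  *-nonzero {x} {y} x≉0 y≉0 xy≈0 = y≉0 (*-cancelˡ x≉0 (trans xy≈0 (sym (zeroʳ x))))

  zero-product : ∀ {x y} → x * y ≈ 0# → x ≈ 0# ⊎ y ≈ 0#
  zero-product {x} {y} xy≈0 with x ≈? 0#
  ... | yes x≈0 = inj₁ x≈0
  ... | no x≉0  = inj₂ (*-cancelˡ x≉0 (trans xy≈0 (sym (zeroʳ x))))

  -1≉0 : ¬ - 1# ≈ 0#
  -1≉0 -1≈0 = 0≉1 (sym (trans (sym (⁻¹-involutive 1#)) (trans (-‿cong -1≈0) ε⁻¹≈ε)))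

  -x*-y≈x*y : ∀ x y → - x * - y ≈ x * y
  -x*-y≈x*y x y = begin
    - x * - y      ≈⟨ -‿distribˡ-* x (- y) ⟨
    - (x * - y)    ≈⟨ -‿cong (-‿distribʳ-* x y) ⟨
    - - (x * y)    ≈⟨ ⁻¹-involutive (x * y) ⟩
    x * y          ∎

  x*[y-y]≈0 : ∀ x y → x * (y - y) ≈ 0#
  x*[y-y]≈0 x y = trans (*-congˡ (-‿inverseʳ y)) (zeroʳ x)

  x²+yz≈xy+xz⇒x≈y⊎x≈z : ∀ x y z → x * x + y * z ≈ x * y + x * z → x ≈ y ⊎ x ≈ z
  x²+yz≈xy+xz⇒x≈y⊎x≈z x y z eq with zero-product (identityˡ-unique _ _ (begin
    (x - y) * (x - z) + (x * y + x * z)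
      ≈⟨ solve 5 (λ x y z y′ z′ → (x :+ y′) :* (x :+ z′) :+ (x :* y :+ x :* z)
                                := x :* x :+ y′ :* z′ :+ (x :* (y :+ y′) :+ x :* (z :+ z′))) refl x y z (- y) (- z) ⟩
    x * x + - y * - z + (x * (y - y) + x * (z - z))
      ≈⟨ +-cong (+-congˡ (-x*-y≈x*y y z)) (+-cong (x*[y-y]≈0 x y) (x*[y-y]≈0 x z)) ⟩
    x * x + y * z + (0# + 0#)
      ≈⟨ trans (+-congˡ (+-identityʳ 0#)) (+-identityʳ _) ⟩
    x * x + y * z
      ≈⟨ eq ⟩
    x * y + x * z ∎))
  ... | inj₁ x-y≈0 = inj₁ (x∙y⁻¹≈ε⇒x≈y x y x-y≈0)
  ... | inj₂ x-z≈0 = inj₂ (x∙y⁻¹≈ε⇒x≈y x z x-z≈0)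

  x*x≈1⇒x≈1⊎x≈-1 : ∀ {x} → x * x ≈ 1# → x ≈ 1# ⊎ x ≈ - 1#
  x*x≈1⇒x≈1⊎x≈-1 {x} xx≈1 = x²+yz≈xy+xz⇒x≈y⊎x≈z x 1# (- 1#) (begin
    x * x + 1# * - 1#    ≈⟨ +-cong xx≈1 (*-identityˡ (- 1#)) ⟩
    1# - 1#              ≈⟨ -‿inverseʳ 1# ⟩
    0#                   ≈⟨ -‿inverseʳ x ⟨
    x - x                ≈⟨ +-cong (*-identityʳ x) (trans (sym (-‿distribʳ-* x 1#)) (-‿cong (*-identityʳ x))) ⟨
    x * 1# + x * - 1#    ∎)

  ^-congˡ : ∀ {x y} n → x ≈ y → x ^ n ≈ y ^ n
  ^-congˡ zero    x≈y = refl
  ^-congˡ (suc n) x≈y = *-cong x≈y (^-congˡ n x≈y)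

  ^-congʳ : ∀ x {m n} → m ≡ n → x ^ m ≈ x ^ n
  ^-congʳ x m≡n = reflexive (≡.cong (x ^_) m≡n)

  ^-homo-* : ∀ x m n → x ^ (m ℕ.+ n) ≈ x ^ m * x ^ n
  ^-homo-* x zero    n = sym (*-identityˡ _)
  ^-homo-* x (suc m) n = trans (*-congˡ (^-homo-* x m n)) (sym (*-assoc x (x ^ m) (x ^ n)))

  ^-distrib-* : ∀ x y n → (x * y) ^ n ≈ x ^ n * y ^ n
  ^-distrib-* x y zero    = sym (*-identityˡ 1#)
  ^-distrib-* x y (suc n) = trans (*-congˡ (^-distrib-* x y n))
    (solve 4 (λ x y xⁿ yⁿ → (x :* y) :* (xⁿ :* yⁿ) := (x :* xⁿ) :* (y :* yⁿ)) refl x y (x ^ n) (y ^ n))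

  1^n≈1 : ∀ n → 1# ^ n ≈ 1#
  1^n≈1 zero    = refl
  1^n≈1 (suc n) = trans (*-identityˡ _) (1^n≈1 n)

  ^-assocʳ : ∀ x m n → (x ^ m) ^ n ≈ x ^ (m ℕ.* n)
  ^-assocʳ x zero    n = 1^n≈1 n
  ^-assocʳ x (suc m) n = begin
    (x * x ^ m) ^ n        ≈⟨ ^-distrib-* x (x ^ m) n ⟩
    x ^ n * (x ^ m) ^ n    ≈⟨ *-congˡ (^-assocʳ x m n) ⟩
    x ^ n * x ^ (m ℕ.* n)  ≈⟨ ^-homo-* x n (m ℕ.* n) ⟨
    x ^ (n ℕ.+ m ℕ.* n)    ∎
  ^-nonzero : ∀ {x} n → ¬ x ≈ 0# → ¬ x ^ n ≈ 0#
  ^-nonzero zero    x≉0 1≈0 = 0≉1 (sym 1≈0)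
  ^-nonzero (suc n) x≉0     = *-nonzero x≉0 (^-nonzero n x≉0)

  ^≈1⇒^*≈1 : ∀ {x} m n → x ^ m ≈ 1# → x ^ (m ℕ.* n) ≈ 1#
  ^≈1⇒^*≈1 {x} m n xᵐ≈1 = begin
    x ^ (m ℕ.* n)  ≈⟨ ^-assocʳ x m n ⟨
    (x ^ m) ^ n    ≈⟨ ^-congˡ n xᵐ≈1 ⟩
    1# ^ n         ≈⟨ 1^n≈1 n ⟩
    1#             ∎

  x^i≈x^j⇒x^[j∸i]≈1 : ∀ {x} i j → ¬ x ≈ 0# → i ℕ.≤ j → x ^ i ≈ x ^ j → x ^ (j ∸ i) ≈ 1#
  x^i≈x^j⇒x^[j∸i]≈1 {x} i j x≉0 i≤j xⁱ≈xʲ = sym (*-cancelˡ (^-nonzero i x≉0) (begin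
    x ^ i * 1#           ≈⟨ *-identityʳ _ ⟩
    x ^ i                ≈⟨ xⁱ≈xʲ ⟩
    x ^ j                ≈⟨ ^-congʳ x (ℕ.m+[n∸m]≡n i≤j) ⟨
    x ^ (i ℕ.+ (j ∸ i))  ≈⟨ ^-homo-* x i (j ∸ i) ⟩
    x ^ i * x ^ (j ∸ i)  ∎))

  order-nonzero : ∀ {x m} → HasOrder x m → ¬ x ≈ 0#
  order-nonzero {x} {suc m} (_ , xᵐ⁺¹≈1 , _) x≈0 =
    0≉1 (trans (sym (trans (*-congʳ x≈0) (zeroˡ (x ^ m)))) xᵐ⁺¹≈1)

  order-cong : ∀ {x y m} → x ≈ y → HasOrder x m → HasOrder y m
  order-cong {m = m} x≈y (1≤m , xᵐ≈1 , minimal) =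
    1≤m , trans (^-congˡ m (sym x≈y)) xᵐ≈1 , λ k 1≤k k<m yᵏ≈1 → minimal k 1≤k k<m (trans (^-congˡ k x≈y) yᵏ≈1)

  order∣⇒^≈1 : ∀ {x m k} → HasOrder x m → m ∣ k → x ^ k ≈ 1#
  order∣⇒^≈1 {x} {m} (_ , xᵐ≈1 , _) (divides n ≡.refl) =
    trans (^-congʳ x (ℕ.*-comm n m)) (^≈1⇒^*≈1 m n xᵐ≈1)

  ^≈^%order : ∀ {x m} .{{_ : NonZero m}} → HasOrder x m → ∀ k → x ^ k ≈ x ^ (k % m)
  ^≈^%order {x} {m} order k = begin
    x ^ k                              ≈⟨ ^-congʳ x (m≡m%n+[m/n]*n k m) ⟩
    x ^ (k % m ℕ.+ k / m ℕ.* m)        ≈⟨ ^-homo-* x (k % m) (k / m ℕ.* m) ⟩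
    x ^ (k % m) * x ^ (k / m ℕ.* m)    ≈⟨ *-congˡ (order∣⇒^≈1 order (n∣m*n (k / m))) ⟩
    x ^ (k % m) * 1#                   ≈⟨ *-identityʳ _ ⟩
    x ^ (k % m)                        ∎

  ^≈1⇒order∣ : ∀ {x m k} → HasOrder x m → x ^ k ≈ 1# → m ∣ k
  ^≈1⇒order∣ {m = zero} (() , _)
  ^≈1⇒order∣ {x} {m@(suc _)} {k} order@(_ , _ , minimal) xᵏ≈1 with k % m in k%m≡
  ... | zero  = m%n≡0⇒n∣m k m k%m≡
  ... | suc r = ⊥-elim (minimal (suc r) (s≤s z≤n) (≡.subst (ℕ._< m) k%m≡ (m%n<n k m)) (begin
    x ^ suc r    ≈⟨ ^-congʳ x k%m≡ ⟨
    x ^ (k % m)  ≈⟨ ^≈^%order order k ⟨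
    x ^ k        ≈⟨ xᵏ≈1 ⟩
    1#           ∎))

  hasOrder-intro : ∀ {x m} → 1 ℕ.≤ m → x ^ m ≈ 1# → (∀ k → x ^ k ≈ 1# → m ∣ k) → HasOrder x m
  hasOrder-intro 1≤m xᵐ≈1 divides-all = 1≤m , xᵐ≈1 , λ k 1≤k k<m xᵏ≈1 →
    ℕ.<⇒≱ k<m (∣⇒≤ {{>-nonZero 1≤k}} (divides-all k xᵏ≈1))

  order-unique : ∀ {x m n} → HasOrder x m → HasOrder x n → m ≡ n
  order-unique xᵐ xⁿ = ∣-antisym (^≈1⇒order∣ xᵐ (proj₁ (proj₂ xⁿ))) (^≈1⇒order∣ xⁿ (proj₁ (proj₂ xᵐ)))

  order-^ : ∀ {x} k j → HasOrder x (k ℕ.* j) → HasOrder (x ^ k) j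
  order-^ {x} k j order@(1≤kj , _) = hasOrder-intro (>-nonZero⁻¹ j)
    (trans (^-assocʳ x k j) (order∣⇒^≈1 order ∣-refl))
    (λ i xᵏⁱ≈1 → *-cancelˡ-∣ k (^≈1⇒order∣ order (trans (sym (^-assocʳ x k i)) xᵏⁱ≈1)))
    where
    instance
      _ = ℕ.m*n≢0⇒m≢0 k {{>-nonZero 1≤kj}}
      _ = ℕ.m*n≢0⇒n≢0 k {{>-nonZero 1≤kj}}

  order-^-coprime : ∀ {x m} k → HasOrder x m → Coprime m k → HasOrder (x ^ k) m
  order-^-coprime {x} {m} k order@(1≤m , _) m⊥k = hasOrder-intro 1≤m
    (trans (^-assocʳ x k m) (order∣⇒^≈1 order (n∣m*n k)))
    (λ i xᵏⁱ≈1 → coprime-divisor m⊥k (^≈1⇒order∣ order (trans (sym (^-assocʳ x k i)) xᵏⁱ≈1)))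

  order-^⇒coprime : ∀ {x m} k → HasOrder x m → HasOrder (x ^ k) m → Coprime k m
  order-^⇒coprime {x} {m} k order@(1≤m , _) orderᵏ {i} (divides a ≡.refl , divides b m≡bi) =
    ≡.sym (ℕ.*-cancelˡ-≡ 1 i m {{>-nonZero 1≤m}} (≡.trans (ℕ.*-identityʳ m) (≡.trans m≡bi (≡.cong (ℕ._* i) b≡m))))
    where
    m∣kb : m ∣ k ℕ.* b
    m∣kb = ≡.subst₂ _∣_ (≡.sym m≡bi) (ℕ.*-comm b k) (*-pres-∣ (∣-refl {b}) (n∣m*n a))
    b≡m : b ≡ m
    b≡m = ∣-antisym (divides i (≡.trans m≡bi (ℕ.*-comm b i)))
                    (^≈1⇒order∣ orderᵏ (trans (^-assocʳ x k b) (order∣⇒^≈1 order m∣kb)))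

  [xy]ᵏ≈1⇒a∣b*k : ∀ {x y a b k} → HasOrder x a → HasOrder y b → (x * y) ^ k ≈ 1# → a ∣ b ℕ.* k
  [xy]ᵏ≈1⇒a∣b*k {x} {y} {a} {b} {k} orderˣ orderʸ xyᵏ≈1 = ^≈1⇒order∣ orderˣ (begin
    x ^ (b ℕ.* k)                  ≈⟨ *-identityʳ _ ⟨
    x ^ (b ℕ.* k) * 1#             ≈⟨ *-congˡ (order∣⇒^≈1 orderʸ (m∣m*n k)) ⟨
    x ^ (b ℕ.* k) * y ^ (b ℕ.* k)  ≈⟨ ^-distrib-* x y (b ℕ.* k) ⟨
    (x * y) ^ (b ℕ.* k)            ≈⟨ ^-congʳ (x * y) (ℕ.*-comm b k) ⟩
    (x * y) ^ (k ℕ.* b)            ≈⟨ ^≈1⇒^*≈1 k b xyᵏ≈1 ⟩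
    1#                             ∎)

  order-*-coprime : ∀ {x y a b} → HasOrder x a → HasOrder y b → Coprime a b → HasOrder (x * y) (a ℕ.* b)
  order-*-coprime {x} {y} {a} {b} orderˣ@(1≤a , _) orderʸ@(1≤b , _) a⊥b = hasOrder-intro (ℕ.*-mono-≤ 1≤a 1≤b)
    (begin
      (x * y) ^ (a ℕ.* b)            ≈⟨ ^-distrib-* x y (a ℕ.* b) ⟩
      x ^ (a ℕ.* b) * y ^ (a ℕ.* b)  ≈⟨ *-cong (order∣⇒^≈1 orderˣ (m∣m*n b)) (order∣⇒^≈1 orderʸ (n∣m*n a)) ⟩
      1# * 1#                        ≈⟨ *-identityˡ 1# ⟩
      1#                             ∎)
    (λ k xyᵏ≈1 → coprime⇒*∣ a⊥b
      (coprime-divisor a⊥b ([xy]ᵏ≈1⇒a∣b*k orderˣ orderʸ xyᵏ≈1))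
      (coprime-divisor (Coprime.sym a⊥b) ([xy]ᵏ≈1⇒a∣b*k orderʸ orderˣ (trans (^-congˡ k (*-comm y x)) xyᵏ≈1))))

  inverse-^≈1 : ∀ {x y} k → x * y ≈ 1# → y ^ k ≈ 1# → x ^ k ≈ 1#
  inverse-^≈1 {x} {y} k xy≈1 yᵏ≈1 = begin
    x ^ k          ≈⟨ *-identityʳ _ ⟨
    x ^ k * 1#     ≈⟨ *-congˡ yᵏ≈1 ⟨
    x ^ k * y ^ k  ≈⟨ ^-distrib-* x y k ⟨
    (x * y) ^ k    ≈⟨ ^-congˡ k xy≈1 ⟩
    1# ^ k         ≈⟨ 1^n≈1 k ⟩
    1#             ∎

  order-inverse : ∀ {x y m} → x * y ≈ 1# → HasOrder x m → HasOrder y m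
  order-inverse {x} {y} {m} xy≈1 orderˣ@(1≤m , xᵐ≈1 , _) = hasOrder-intro 1≤m
    (inverse-^≈1 m (trans (*-comm y x) xy≈1) xᵐ≈1)
    (λ k yᵏ≈1 → ^≈1⇒order∣ orderˣ (inverse-^≈1 k xy≈1 yᵏ≈1))

  index : Carrier → Fin q
  index y = proj₁ (enum-surj y)

  index-injective : ∀ {x y} → index x ≡ index y → x ≈ y
  index-injective {x} {y} eq = begin
    x                ≈⟨ proj₂ (enum-surj x) ⟨
    enum (index x)   ≡⟨ ≡.cong enum eq ⟩
    enum (index y)   ≈⟨ proj₂ (enum-surj y) ⟩
    y                ∎

  pigeonhole : ∀ {n} → q ℕ.< n → (v : Fin n → Carrier) → ∃₂ λ i j → toℕ i ℕ.< toℕ j × v i ≈ v j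
  pigeonhole q<n v with Fin.pigeonhole q<n (index ∘ v)
  ... | i , j , i<j , eq = i , j , i<j , index-injective eq

  injective⇒≤q : ∀ {n} {v : Fin n → Carrier} → Injective _≡_ _≈_ v → n ℕ.≤ q
  injective⇒≤q v-inj = Fin.injective⇒≤ (v-inj ∘ index-injective)

  surjective⇒q≤ : ∀ {n} {v : Fin n → Carrier} → (∀ y → ∃ λ i → v i ≈ y) → q ℕ.≤ n
  surjective⇒q≤ {v = v} v-surj = Fin.injective⇒≤ {f = proj₁ ∘ v-surj ∘ enum} λ {k} {l} eq →
    enum-inj k l (trans (sym (proj₂ (v-surj (enum k)))) (trans (reflexive (≡.cong v eq)) (proj₂ (v-surj (enum l)))))

  order-exists : ∀ {x} → ¬ x ≈ 0# → ∃ (HasOrder x)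
  order-exists {x} x≉0 with pigeonhole (ℕ.n<1+n q) (λ i → x ^ toℕ i)
  ... | i , j , i<j , xⁱ≈xʲ with minimalWitness (λ k → (1 ℕ.≤? k) ×-dec ((x ^ k) ≈? 1#))
                                  (ℕ.m<n⇒0<n∸m i<j , x^i≈x^j⇒x^[j∸i]≈1 (toℕ i) (toℕ j) x≉0 (ℕ.<⇒≤ i<j) xⁱ≈xʲ)
  ...   | k , (1≤k , xᵏ≈1) , minimal = k , 1≤k , xᵏ≈1 , λ j 1≤j j<k xʲ≈1 → minimal j<k (1≤j , xʲ≈1)

  powers : Carrier → (m : ℕ) → Fin m → Carrier
  powers x m i = x ^ toℕ i

  ^-distinct-below-order : ∀ {x m i j} → HasOrder x m → i ℕ.< j → j ℕ.< m → ¬ x ^ i ≈ x ^ j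
  ^-distinct-below-order {i = i} {j} order@(_ , _ , minimal) i<j j<m xⁱ≈xʲ =
    minimal (j ∸ i) (ℕ.m<n⇒0<n∸m i<j) (ℕ.≤-<-trans (ℕ.m∸n≤m j i) j<m)
      (x^i≈x^j⇒x^[j∸i]≈1 i j (order-nonzero order) (ℕ.<⇒≤ i<j) xⁱ≈xʲ)

  powers-injective : ∀ {x m} → HasOrder x m → Injective _≡_ _≈_ (powers x m)
  powers-injective {m = m} order {i} {j} xⁱ≈xʲ with ℕ.<-cmp (toℕ i) (toℕ j)
  ... | tri< i<j _ _ = contradiction xⁱ≈xʲ (^-distinct-below-order order i<j (Fin.toℕ<n j))
  ... | tri≈ _ i≡j _ = Fin.toℕ-injective i≡j
  ... | tri> _ _ j<i = contradiction (sym xⁱ≈xʲ) (^-distinct-below-order order j<i (Fin.toℕ<n i))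

  ∷-injective : ∀ {n y} {v : Fin n → Carrier} → Injective _≡_ _≈_ v → (∀ i → ¬ y ≈ v i) →
                Injective _≡_ _≈_ (y Vector.∷ v)
  ∷-injective v-inj y∉v {zero}  {zero}  _  = ≡.refl
  ∷-injective v-inj y∉v {zero}  {suc j} eq = contradiction eq (y∉v j)
  ∷-injective v-inj y∉v {suc i} {zero}  eq = contradiction (sym eq) (y∉v i)
  ∷-injective v-inj y∉v {suc i} {suc j} eq = ≡.cong suc (v-inj eq)

  order<q : ∀ {x m} → HasOrder x m → m ℕ.< q
  order<q order = injective⇒≤q (∷-injective (powers-injective order)
    (λ i 0≈xⁱ → ^-nonzero (toℕ i) (order-nonzero order) (sym 0≈xⁱ)))

module Polynomials {c ℓ} (F : FiniteField c ℓ) where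
  open FiniteField F hiding (zero)
  open FieldNotions F
  open FieldArithmetic F
  open import Relation.Binary.Reasoning.Setoid setoid
  open import Algebra.Properties.AbelianGroup +-abelianGroup using (x∙y⁻¹≈ε⇒x≈y)
  open import Algebra.Solver.Ring.NaturalCoefficients.Default commutativeSemiring using (solve; _:+_; _:*_; _:=_)

  -- coefficient lists, constant term first
  eval : List Carrier → Carrier → Carrier
  eval []      z = 0#
  eval (a ∷ p) z = a + z * eval p z

  -- synthetic division by X − r
  divide : Carrier → List Carrier → List Carrier
  divide r (a ∷ p@(_ ∷ _)) = eval p r ∷ divide r p
  divide r _               = []

  divide-length : ∀ r p {n} → length p ℕ.≤ ℕ.suc n → length (divide r p) ℕ.≤ n
  divide-length r []          _         = z≤n
  divide-length r (a ∷ [])    _         = z≤n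
  divide-length r (a ∷ b ∷ p) {ℕ.suc n} (s≤s l) = s≤s (divide-length r (b ∷ p) l)

  remainder-theorem : ∀ r p z → eval p z ≈ (z - r) * eval (divide r p) z + eval p r
  remainder-theorem r [] z = sym (trans (+-identityʳ _) (zeroʳ _))
  remainder-theorem r (a ∷ []) z = begin
    a + z * 0#               ≈⟨ +-congˡ (zeroʳ z) ⟩
    a + 0#                   ≈⟨ +-congˡ (zeroʳ r) ⟨
    a + r * 0#               ≈⟨ +-identityˡ _ ⟨
    0# + (a + r * 0#)        ≈⟨ +-congʳ (zeroʳ (z - r)) ⟨
    (z - r) * 0# + (a + r * 0#) ∎
  remainder-theorem r (a ∷ p@(_ ∷ _)) z = begin
    a + z * eval p z                     ≈⟨ +-congˡ (*-congˡ (remainder-theorem r p z)) ⟩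
    a + z * (w * Q + R)                  ≈⟨ +-congˡ (*-congʳ w+r≈z) ⟨
    a + (w + r) * (w * Q + R)            ≈⟨ solve 5 (λ a w r Q R → a :+ (w :+ r) :* (w :* Q :+ R)
                                                     := w :* (R :+ (w :+ r) :* Q) :+ (a :+ r :* R)) refl a w r Q R ⟩
    w * (R + (w + r) * Q) + (a + r * R)  ≈⟨ +-congʳ (*-congˡ (+-congˡ (*-congʳ w+r≈z))) ⟩
    w * (R + z * Q) + (a + r * R)        ∎
    where
    w = z - r
    Q = eval (divide r p) z
    R = eval p r
    w+r≈z : w + r ≈ z
    w+r≈z = trans (+-assoc z (- r) r) (trans (+-congˡ (-‿inverseˡ r)) (+-identityʳ z))

  vanishes : ∀ {n} p (v : Fin n → Carrier) → length p ℕ.≤ n → Injective _≡_ _≈_ v →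
             (∀ i → eval p (v i) ≈ 0#) → ∀ z → eval p z ≈ 0#
  vanishes {ℕ.zero} []   _ _ _ _ _ = refl
  vanishes {ℕ.suc n} p v len v-inj roots z = begin
    eval p z                                  ≈⟨ remainder-theorem r p z ⟩
    (z - r) * eval (divide r p) z + eval p r  ≈⟨ +-cong (*-congˡ (vanishes (divide r p) (Vector.tail v)
                                                   (divide-length r p len) (Fin.suc-injective ∘ v-inj) quotient-roots z))
                                                 (roots zero) ⟩
    (z - r) * 0# + 0#                         ≈⟨ trans (+-identityʳ _) (zeroʳ _) ⟩
    0#                                        ∎
    where
    r = Vector.head v
    quotient-roots : ∀ i → eval (divide r p) (v (suc i)) ≈ 0#
    quotient-roots i = *-cancelˡ (λ vᵢ-r≈0 → contradiction (v-inj (x∙y⁻¹≈ε⇒x≈y _ _ vᵢ-r≈0)) λ ())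
      (begin
        (v (suc i) - r) * eval (divide r p) (v (suc i))             ≈⟨ +-identityʳ _ ⟨
        (v (suc i) - r) * eval (divide r p) (v (suc i)) + 0#        ≈⟨ +-congˡ (roots zero) ⟨
        (v (suc i) - r) * eval (divide r p) (v (suc i)) + eval p r  ≈⟨ remainder-theorem r p (v (suc i)) ⟨
        eval p (v (suc i))                                          ≈⟨ roots (suc i) ⟩
        0#                                                          ≈⟨ zeroʳ _ ⟨
        (v (suc i) - r) * 0#                                        ∎)

module Cyclicity {c ℓ} (F : FiniteField c ℓ) where
  open FiniteField F hiding (zero)
  open FieldNotions F
  open FieldArithmetic F
  open Polynomials F

  monomial : ℕ → List Carrier
  monomial ℕ.zero    = 1# ∷ []
  monomial (ℕ.suc n) = 0# ∷ monomial n

  eval-monomial : ∀ n z → eval (monomial n) z ≈ z ^ n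
  eval-monomial ℕ.zero    z = trans (+-congˡ (zeroʳ z)) (+-identityʳ 1#)
  eval-monomial (ℕ.suc n) z = trans (+-identityˡ _) (*-congˡ (eval-monomial n z))

  length-monomial : ∀ n → length (monomial n) ≡ ℕ.suc n
  length-monomial ℕ.zero    = ≡.refl
  length-monomial (ℕ.suc n) = ≡.cong ℕ.suc (length-monomial n)

  ∷-powers-injective : ∀ {x m y} → HasOrder x m → (∀ {k} → k ℕ.< m → ¬ y ≈ x ^ k) →
                       Injective _≡_ _≈_ (y Vector.∷ powers x m)
  ∷-powers-injective order y∉xᵏ = ∷-injective (powers-injective order) (λ i → y∉xᵏ (Fin.toℕ<n i))

  -- otherwise y, 1, x, …, x ^ (m ∸ 1) would be m + 1 distinct roots of X ^ m − 1
  root-of-unity⇒power : ∀ {x m y} → HasOrder x m → y ^ m ≈ 1# → ∃ λ k → k ℕ.< m × y ≈ x ^ k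
  root-of-unity⇒power {m = ℕ.zero} (() , _) _
  root-of-unity⇒power {x} {m@(ℕ.suc n)} {y} order yᵐ≈1 with anyUpTo? (λ k → y ≈? (x ^ k)) m
  ... | yes found = found
  ... | no y∉xᵏ = contradiction
    (trans (sym (trans (+-congˡ (zeroˡ _)) (+-identityʳ _)))
           (vanishes Xᵐ-1 v (ℕ.≤-reflexive (≡.cong ℕ.suc (length-monomial n)))
              (∷-powers-injective order (λ k<m y≈xᵏ → y∉xᵏ (_ , k<m , y≈xᵏ))) roots 0#))
    -1≉0
    where
    Xᵐ-1 = - 1# ∷ monomial n
    v = y Vector.∷ powers x m
    unity : ∀ i → v i ^ m ≈ 1#
    unity zero    = yᵐ≈1
    unity (suc i) = trans (^-assocʳ x (toℕ i) m) (order∣⇒^≈1 order (n∣m*n (toℕ i)))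
    roots : ∀ i → eval Xᵐ-1 (v i) ≈ 0#
    roots i = trans (+-congˡ (trans (*-congˡ (eval-monomial n (v i))) (unity i))) (-‿inverseˡ 1#)

  generator-of-order : ∀ {x m} → HasOrder x m → q ℕ.≤ ℕ.suc m → Generates x
  generator-of-order {x} {m} order q≤1+m = order-nonzero order , power
    where
    power : ∀ y → ¬ y ≈ 0# → ∃ λ k → x ^ k ≈ y
    power y y≉0 with anyUpTo? (λ k → y ≈? (x ^ k)) m
    ... | yes (k , _ , y≈xᵏ) = k , sym y≈xᵏ
    ... | no y∉xᵏ = contradiction (ℕ.≤-trans (injective⇒≤q (∷-injective
                      (∷-powers-injective order (λ k<m y≈xᵏ → y∉xᵏ (_ , k<m , y≈xᵏ))) 0∉v)) q≤1+m) ℕ.1+n≰n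
      where
      0∉v : ∀ i → ¬ 0# ≈ (y Vector.∷ powers x m) i
      0∉v zero    0≈y  = y≉0 (sym 0≈y)
      0∉v (suc i) 0≈xⁱ = ^-nonzero (toℕ i) (order-nonzero order) (sym 0≈xⁱ)

  Exponent : ℕ → Set (c ⊔ ℓ)
  Exponent m = ∀ y → ¬ y ≈ 0# → y ^ m ≈ 1#

  exponent? : ∀ m → Exponent m ⊎ ∃ λ y → ¬ y ≈ 0# × ¬ y ^ m ≈ 1#
  exponent? m with Fin.any? (λ i → ¬? (enum i ≈? 0#) ×-dec ¬? ((enum i ^ m) ≈? 1#))
  ... | yes (i , witness) = inj₂ (enum i , witness)
  ... | no none = inj₁ λ y y≉0 → decidable-stable ((y ^ m) ≈? 1#) λ yᵐ≉1 →
    let i , enumᵢ≈y = enum-surj y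
    in  none (i , (λ enumᵢ≈0 → y≉0 (trans (sym enumᵢ≈y) enumᵢ≈0))
                , (λ enumᵢᵐ≈1 → yᵐ≉1 (trans (^-congˡ m (sym enumᵢ≈y)) enumᵢᵐ≈1)))

  -- If the order b of y does not divide m, some prime p occurs in b to a higher power pᵉ than in m = pᶠ m′;
  -- then y ^ (b / pᵉ) has order pᵉ, x ^ pᶠ has order m′, and their product has order pᵉ m′ > m.
  abstract
    larger-order : ∀ {x m y} → HasOrder x m → ¬ y ≈ 0# → ¬ y ^ m ≈ 1# → ∃₂ λ z n → HasOrder z n × m ℕ.< n
    larger-order {x} {m} {y} orderˣ@(1≤m , _) y≉0 yᵐ≉1 with order-exists y≉0
    ... | b , orderʸ@(1≤b , _) =
      _ , _ , order-*-coprime orderʸ′ orderˣ′ (prime^-coprime e p-prime p∤m′) , m<pᵉm′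
      where
      open ExcessPrimePower (excessPrimePower {{>-nonZero 1≤b}} {{>-nonZero 1≤m}} (yᵐ≉1 ∘ order∣⇒^≈1 orderʸ))
      orderʸ′ : HasOrder (y ^ quotient pᵉ∣b) (p ℕ.^ e)
      orderʸ′ = order-^ (quotient pᵉ∣b) (p ℕ.^ e) (≡.subst (HasOrder y) (m∣n⇒n≡quotient*m pᵉ∣b) orderʸ)
      orderˣ′ : HasOrder (x ^ (p ℕ.^ f)) m′
      orderˣ′ = order-^ (p ℕ.^ f) m′ (≡.subst (HasOrder x) m≡pᶠm′ orderˣ)
      m<pᵉm′ : m ℕ.< p ℕ.^ e ℕ.* m′
      m<pᵉm′ = ≡.subst (ℕ._< p ℕ.^ e ℕ.* m′) (≡.sym m≡pᶠm′)
        (ℕ.*-monoˡ-< m′ {{ℕ.m*n≢0⇒n≢0 (p ℕ.^ f) {{≡.subst NonZero m≡pᶠm′ (>-nonZero 1≤m)}}}}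
          (ℕ.^-monoʳ-< p (prime>1 p-prime) f<e))

  -- each step strictly increases an order bounded by q, so q steps suffice
  exponent-element : ∃₂ λ x m → HasOrder x m × Exponent m
  exponent-element = improve q order[1] (ℕ.m≤m+n q 1)
    where
    order[1] : HasOrder 1# 1
    order[1] = s≤s z≤n , *-identityʳ 1# , λ k 1≤k k<1 → contradiction 1≤k (ℕ.<⇒≱ k<1)
    improve : ∀ fuel {x m} → HasOrder x m → q ℕ.≤ fuel ℕ.+ m → ∃₂ λ x m → HasOrder x m × Exponent m
    improve ℕ.zero       order q≤m = contradiction q≤m (ℕ.<⇒≱ (order<q order))
    improve (ℕ.suc fuel) {x} {m} order q≤1+fuel+m with exponent? m
    ... | inj₁ exponent = x , m , order , exponent
    ... | inj₂ (y , y≉0 , yᵐ≉1) with larger-order order y≉0 yᵐ≉1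
    ...   | _ , n , orderⁿ , m<n = improve fuel orderⁿ (ℕ.≤-trans q≤1+fuel+m
              (ℕ.≤-trans (ℕ.≤-reflexive (≡.sym (ℕ.+-suc fuel m))) (ℕ.+-monoʳ-≤ fuel m<n)))

  primitive-element : ∃₂ λ g m → ℕ.suc m ≡ q × HasOrder g m
  primitive-element with exponent-element
  ... | x , m , order , exponent = x , m , ℕ.≤-antisym (order<q order) (surjective⇒q≤ cover) , order
    where
    cover : ∀ y → ∃ λ i → (0# Vector.∷ powers x m) i ≈ y
    cover y with y ≈? 0#
    ... | yes y≈0 = zero , sym y≈0
    ... | no y≉0 with root-of-unity⇒power order (exponent y y≉0)
    ...   | k , k<m , y≈xᵏ = suc (fromℕ< k<m) , trans (^-congʳ x (Fin.toℕ-fromℕ< k<m)) (sym y≈xᵏ)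

module QuadraticRoots {c ℓ} (F : FiniteField c ℓ) where
  open FiniteField F hiding (zero)
  open FieldNotions F
  open FieldArithmetic F
  open import Relation.Binary.Reasoning.Setoid setoid
  open import Algebra.Properties.Ring ring using (x[y-z]≈xy-xz)
  open import Algebra.Properties.AbelianGroup +-abelianGroup
    using (⁻¹-anti-homo‿-; xyx⁻¹≈y; ⁻¹-injective; x∙y⁻¹≈ε⇒x≈y; x≈y⇒x∙y⁻¹≈ε)

  x+[y-x]≈y : ∀ x y → x + (y - x) ≈ y
  x+[y-x]≈y x y = trans (sym (+-assoc x y (- x))) (xyx⁻¹≈y x y)

  γ[a-γ]≈-[γ²-aγ] : ∀ a γ → γ * (a - γ) ≈ - (γ * γ - a * γ)
  γ[a-γ]≈-[γ²-aγ] a γ = begin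
    γ * (a - γ)          ≈⟨ x[y-z]≈xy-xz γ a γ ⟩
    γ * a - γ * γ        ≈⟨ +-congʳ (*-comm γ a) ⟩
    a * γ - γ * γ        ≈⟨ ⁻¹-anti-homo‿- (γ * γ) (a * γ) ⟨
    - (γ * γ - a * γ)    ∎

  root⇒γ[a-γ]≈-1 : ∀ {a γ} → IsRoot a γ → γ * (a - γ) ≈ - 1#
  root⇒γ[a-γ]≈-1 {a} {γ} root = trans (γ[a-γ]≈-[γ²-aγ] a γ) (-‿cong (x∙y⁻¹≈ε⇒x≈y _ _ root))

  γ[a-γ]≈-1⇒root : ∀ {a γ} → γ * (a - γ) ≈ - 1# → IsRoot a γ
  γ[a-γ]≈-1⇒root {a} {γ} eq = x≈y⇒x∙y⁻¹≈ε (⁻¹-injective (trans (sym (γ[a-γ]≈-[γ²-aγ] a γ)) eq))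

  IsRoot-resp : ∀ {a b γ δ} → a ≈ b → γ ≈ δ → IsRoot a γ → IsRoot b δ
  IsRoot-resp {a} {b} {γ} {δ} a≈b γ≈δ root = γ[a-γ]≈-1⇒root (begin
    δ * (b - δ)   ≈⟨ *-cong (sym γ≈δ) (+-cong (sym a≈b) (-‿cong (sym γ≈δ))) ⟩
    γ * (a - γ)   ≈⟨ root⇒γ[a-γ]≈-1 root ⟩
    - 1#          ∎)

  root-conjugate : ∀ {a γ} → IsRoot a γ → IsRoot a (a - γ)
  root-conjugate {a} {γ} root = γ[a-γ]≈-1⇒root (begin
    (a - γ) * (a - (a - γ))  ≈⟨ *-congˡ (trans (+-congˡ (⁻¹-anti-homo‿- a γ)) (x+[y-x]≈y a γ)) ⟩
    (a - γ) * γ              ≈⟨ *-comm (a - γ) γ ⟩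
    γ * (a - γ)              ≈⟨ root⇒γ[a-γ]≈-1 root ⟩
    - 1#                     ∎)

  roots-of-quadratic : ∀ {a γ δ} → IsRoot a γ → IsRoot a δ → δ ≈ γ ⊎ δ ≈ a - γ
  roots-of-quadratic {a} {γ} {δ} rootᵞ rootᵟ = x²+yz≈xy+xz⇒x≈y⊎x≈z δ γ (a - γ) (begin
    δ * δ + γ * (a - γ)        ≈⟨ +-congˡ (trans (root⇒γ[a-γ]≈-1 rootᵞ) (sym (root⇒γ[a-γ]≈-1 rootᵟ))) ⟩
    δ * δ + δ * (a - δ)        ≈⟨ distribˡ δ δ (a - δ) ⟨
    δ * (δ + (a - δ))          ≈⟨ *-congˡ (trans (x+[y-x]≈y δ a) (sym (x+[y-x]≈y γ a))) ⟩
    δ * (γ + (a - γ))          ≈⟨ distribˡ δ γ (a - γ) ⟩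
    δ * γ + δ * (a - γ)        ∎)

module LucasPrimitiveRoots {c ℓ} (F : FiniteField c ℓ) (q≡3[4] : FiniteField.q F % 4 ≡ 3) where
  open FiniteField F hiding (zero)
  open FieldNotions F
  open FieldArithmetic F
  open Cyclicity F
  open QuadraticRoots F
  open import Relation.Binary.Reasoning.Setoid setoid
  open import Algebra.Properties.Ring ring using (-‿distribˡ-*; -‿distribʳ-*; -1*x≈-x)
  open import Algebra.Properties.AbelianGroup +-abelianGroup using (⁻¹-involutive; xyx⁻¹≈y)

  s t : ℕ
  s = q / 2
  t = q / 4

  s≡1+2t : s ≡ ℕ.suc (t ℕ.* 2)
  s≡1+2t = proj₁ (≡3mod4⇒halves q q≡3[4])

  q≡1+2s : q ≡ ℕ.suc (s ℕ.* 2)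
  q≡1+2s = proj₂ (≡3mod4⇒halves q q≡3[4])

  1≤s : 1 ℕ.≤ s
  1≤s = ≡.subst (1 ℕ.≤_) (≡.sym s≡1+2t) (s≤s z≤n)

  s<2s : s ℕ.< s ℕ.* 2
  s<2s = ℕ.m<m*n s 2 {{>-nonZero 1≤s}} (s≤s (s≤s z≤n))

  abstract
    generator : ∃ λ g → HasOrder g (s ℕ.* 2)
    generator with primitive-element
    ... | g , m , 1+m≡q , order = g , ≡.subst (HasOrder g) (ℕ.suc-injective (≡.trans 1+m≡q q≡1+2s)) order

  order-2s⇒^s≈-1 : ∀ {x} → HasOrder x (s ℕ.* 2) → x ^ s ≈ - 1#
  order-2s⇒^s≈-1 {x} (_ , x²ˢ≈1 , minimal) with x*x≈1⇒x≈1⊎x≈-1 (begin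
    x ^ s * x ^ s   ≈⟨ *-congˡ (*-identityʳ (x ^ s)) ⟨
    (x ^ s) ^ 2     ≈⟨ ^-assocʳ x s 2 ⟩
    x ^ (s ℕ.* 2)   ≈⟨ x²ˢ≈1 ⟩
    1#              ∎)
  ... | inj₁ xˢ≈1  = contradiction xˢ≈1 (minimal s 1≤s s<2s)
  ... | inj₂ xˢ≈-1 = xˢ≈-1

  -1≉1 : ¬ - 1# ≈ 1#
  -1≉1 -1≈1 = let g , order[g]@(_ , _ , minimal) = generator in
    minimal s 1≤s s<2s (trans (order-2s⇒^s≈-1 order[g]) -1≈1)

  order[-1] : HasOrder (- 1#) 2
  order[-1] = s≤s z≤n , trans (*-congˡ (*-identityʳ _)) (trans (-x*-y≈x*y 1# 1#) (*-identityˡ 1#)) , minimal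
    where
    minimal : ∀ m → 1 ℕ.≤ m → m ℕ.< 2 → ¬ (- 1#) ^ m ≈ 1#
    minimal 1 _ _ -1≈1 = -1≉1 (trans (sym (*-identityʳ _)) -1≈1)
    minimal (ℕ.suc (ℕ.suc _)) _ (s≤s (s≤s ()))

  [-1]^s≈-1 : (- 1#) ^ s ≈ - 1#
  [-1]^s≈-1 = begin
    (- 1#) ^ s                           ≈⟨ ^-congʳ (- 1#) s≡1+2t ⟩
    - 1# * (- 1#) ^ (t ℕ.* 2)            ≈⟨ *-congˡ (order∣⇒^≈1 order[-1] (n∣m*n t)) ⟩
    - 1# * 1#                            ≈⟨ *-identityʳ (- 1#) ⟩
    - 1#                                 ∎

  h : Carrier
  h = proj₁ generator ^ 2

  order[h] : HasOrder h s
  order[h] = order-^ 2 s (≡.subst (HasOrder _) (ℕ.*-comm s 2) (proj₂ generator))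

  hˢ≈1 : h ^ s ≈ 1#
  hˢ≈1 = proj₁ (proj₂ order[h])

  h^≉-1 : ∀ k → ¬ h ^ k ≈ - 1#
  h^≉-1 k hᵏ≈-1 = -1≉1 (begin
    - 1#          ≈⟨ [-1]^s≈-1 ⟨
    (- 1#) ^ s    ≈⟨ ^-congˡ s hᵏ≈-1 ⟨
    (h ^ k) ^ s   ≈⟨ ^-assocʳ h k s ⟩
    h ^ (k ℕ.* s) ≈⟨ order∣⇒^≈1 order[h] (n∣m*n k) ⟩
    1#            ∎)

  generates⇒order : ∀ {x} → Generates x → HasOrder x (s ℕ.* 2)
  generates⇒order {x} (x≉0 , powers-of-x) with order-exists x≉0 | generator
  ... | M , orderᴹ@(1≤M , xᴹ≈1 , _) | g , order[g] with powers-of-x g (order-nonzero order[g])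
  ...   | k , xᵏ≈g = ≡.subst (HasOrder x) M≡2s orderᴹ
    where
    2s∣M : s ℕ.* 2 ∣ M
    2s∣M = ^≈1⇒order∣ order[g] (begin
      g ^ M            ≈⟨ ^-congˡ M xᵏ≈g ⟨
      (x ^ k) ^ M      ≈⟨ ^-assocʳ x k M ⟩
      x ^ (k ℕ.* M)    ≈⟨ ^-congʳ x (ℕ.*-comm k M) ⟩
      x ^ (M ℕ.* k)    ≈⟨ ^≈1⇒^*≈1 M k xᴹ≈1 ⟩
      1#               ∎)
    M≡2s : M ≡ s ℕ.* 2
    M≡2s = ℕ.≤-antisym (ℕ.≤-pred (≡.subst (M ℕ.<_) q≡1+2s (order<q orderᴹ))) (∣⇒≤ {{>-nonZero 1≤M}} 2s∣M)

  conjugate-of-order-s-is-LPR : ∀ {a γ₁ γ₂} → IsRoot a γ₁ → HasOrder γ₁ s → γ₂ ≈ a - γ₁ → LPR a γ₂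
  conjugate-of-order-s-is-LPR {a} {γ₁} {γ₂} root₁ order₁ γ₂≈a-γ₁ =
    IsRoot-resp refl (sym γ₂≈a-γ₁) (root-conjugate root₁) ,
    generator-of-order order₂ (ℕ.≤-reflexive q≡1+2s)
    where
    γ₁γ₂≈-1 : γ₁ * γ₂ ≈ - 1#
    γ₁γ₂≈-1 = trans (*-congˡ γ₂≈a-γ₁) (root⇒γ[a-γ]≈-1 root₁)
    γ₁[-γ₂]≈1 : γ₁ * - γ₂ ≈ 1#
    γ₁[-γ₂]≈1 = trans (sym (-‿distribʳ-* γ₁ γ₂)) (trans (-‿cong γ₁γ₂≈-1) (⁻¹-involutive 1#))
    2⊥s : Coprime 2 s
    2⊥s = ≡.subst (Coprime 2) (≡.sym s≡1+2t) (coprime[2,1+2t] t)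
    order₂ : HasOrder γ₂ (s ℕ.* 2)
    order₂ = ≡.subst (HasOrder γ₂) (ℕ.*-comm 2 s)
      (order-cong (trans (-1*x≈-x (- γ₂)) (⁻¹-involutive γ₂))
        (order-*-coprime order[-1] (order-inverse γ₁[-γ₂]≈1 order₁) 2⊥s))

  -- γ′ = − γ⁻¹ = γ ^ (s − 1) = (γ ^ 2) ^ t, as γ ^ s ≈ − 1
  LPR⇒conjugate-order : ∀ {a γ γ′} → LPR a γ → γ′ ≈ a - γ → HasOrder γ′ s
  LPR⇒conjugate-order {a} {γ} {γ′} (root , generates) γ′≈a-γ = order-cong (sym γ′≈γ²ᵗ) (order-^-coprime t order[γ²] s⊥t)
    where
    order[γ] : HasOrder γ (s ℕ.* 2)
    order[γ] = generates⇒order generates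
    order[γ²] : HasOrder (γ ^ 2) s
    order[γ²] = order-^ 2 s (≡.subst (HasOrder γ) (ℕ.*-comm s 2) order[γ])
    s⊥t : Coprime s t
    s⊥t = ≡.subst (λ n → Coprime n t) (≡.sym s≡1+2t) (coprime[1+2t,t] t)
    γ′≈γ²ᵗ : γ′ ≈ (γ ^ 2) ^ t
    γ′≈γ²ᵗ = trans
      (*-cancelˡ (order-nonzero order[γ]) (begin
        γ * γ′                  ≈⟨ *-congˡ γ′≈a-γ ⟩
        γ * (a - γ)             ≈⟨ root⇒γ[a-γ]≈-1 root ⟩
        - 1#                    ≈⟨ order-2s⇒^s≈-1 order[γ] ⟨
        γ ^ s                   ≈⟨ ^-congʳ γ s≡1+2t ⟩
        γ * γ ^ (t ℕ.* 2)       ∎))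
      (trans (^-congʳ γ (ℕ.*-comm t 2)) (sym (^-assocʳ γ 2 t)))

  LPR-unique : ∀ {a γ γ′} → LPR a γ → LPR a γ′ → γ ≈ γ′
  LPR-unique lpr@(root , _) (root′ , generates′) with roots-of-quadratic root root′
  ... | inj₁ γ′≈γ   = sym γ′≈γ
  ... | inj₂ γ′≈a-γ = contradiction
    (order-unique (LPR⇒conjugate-order lpr γ′≈a-γ) (generates⇒order generates′)) (ℕ.<⇒≢ s<2s)

  -- the a for which x² − a x − 1 has the roots h ^ k and − h ^ (s − k)
  trace : ℕ → Carrier
  trace k = h ^ k - h ^ (s ∸ k)

  hᵏhˢ⁻ᵏ≈1 : ∀ {k} → k ℕ.≤ s → h ^ k * h ^ (s ∸ k) ≈ 1#
  hᵏhˢ⁻ᵏ≈1 {k} k≤s = trans (sym (^-homo-* h k (s ∸ k))) (trans (^-congʳ h (ℕ.m+[n∸m]≡n k≤s)) hˢ≈1)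

  trace-conjugate : ∀ k → trace k - h ^ k ≈ - h ^ (s ∸ k)
  trace-conjugate k = xyx⁻¹≈y (h ^ k) (- h ^ (s ∸ k))

  trace-root : ∀ {k} → k ℕ.≤ s → IsRoot (trace k) (h ^ k)
  trace-root {k} k≤s = γ[a-γ]≈-1⇒root (begin
    h ^ k * (trace k - h ^ k)     ≈⟨ *-congˡ (trace-conjugate k) ⟩
    h ^ k * - h ^ (s ∸ k)         ≈⟨ -‿distribʳ-* (h ^ k) (h ^ (s ∸ k)) ⟨
    - (h ^ k * h ^ (s ∸ k))       ≈⟨ -‿cong (hᵏhˢ⁻ᵏ≈1 k≤s) ⟩
    - 1#                          ∎)

  trace-LPR : ∀ {k} → k ℕ.≤ s → Coprime k s → ∃ (LPR (trace k))
  trace-LPR {k} k≤s k⊥s = _ , conjugate-of-order-s-is-LPR (trace-root k≤s) (order-^-coprime k order[h] (Coprime.sym k⊥s)) refl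

  trace-injective : ∀ {i j} → i ℕ.< j → j ℕ.< s → ¬ trace (ℕ.suc i) ≈ trace (ℕ.suc j)
  trace-injective {i} {j} i<j j<s trace≈ =
    [ hᴶ≉hᴵ , hᴶ≉trace-hᴵ ]′ (roots-of-quadratic {trace I} {h ^ I} {h ^ J} (trace-root I≤s) root)
    where
    I J : ℕ
    I = ℕ.suc i
    J = ℕ.suc j
    I≤s : I ℕ.≤ s
    I≤s = ℕ.<-trans i<j j<s
    root : IsRoot (trace I) (h ^ J)
    root = IsRoot-resp (sym trace≈) refl (trace-root j<s)
    hᴶ≉hᴵ : ¬ h ^ J ≈ h ^ I
    hᴶ≉hᴵ hᴶ≈hᴵ = proj₂ (proj₂ order[h]) (j ∸ i) (ℕ.m<n⇒0<n∸m i<j) (ℕ.≤-<-trans (ℕ.m∸n≤m j i) j<s)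
      (x^i≈x^j⇒x^[j∸i]≈1 I J (order-nonzero order[h]) (s≤s (ℕ.<⇒≤ i<j)) (sym hᴶ≈hᴵ))
    hᴶ≉trace-hᴵ : ¬ h ^ J ≈ trace I - h ^ I
    hᴶ≉trace-hᴵ hᴶ≈trace-hᴵ = h^≉-1 (J ℕ.+ I) (begin
      h ^ (J ℕ.+ I)               ≈⟨ ^-homo-* h J I ⟩
      h ^ J * h ^ I               ≈⟨ *-congʳ (trans hᴶ≈trace-hᴵ (trace-conjugate I)) ⟩
      - h ^ (s ∸ I) * h ^ I       ≈⟨ -‿distribˡ-* (h ^ (s ∸ I)) (h ^ I) ⟨
      - (h ^ (s ∸ I) * h ^ I)     ≈⟨ -‿cong (trans (*-comm (h ^ (s ∸ I)) (h ^ I)) (hᵏhˢ⁻ᵏ≈1 I≤s)) ⟩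
      - 1#                        ∎)

  root-of-unity⇒positive-power : ∀ {y} → y ^ s ≈ 1# → ∃ λ i → i ℕ.< s × y ≈ h ^ ℕ.suc i
  root-of-unity⇒positive-power yˢ≈1 = shift (root-of-unity⇒power order[h] yˢ≈1)
    where
    shift : ∀ {y} → ∃ (λ k → k ℕ.< s × y ≈ h ^ k) → ∃ λ i → i ℕ.< s × y ≈ h ^ ℕ.suc i
    shift (ℕ.zero  , _     , y≈1)   = t ℕ.* 2 , ≡.subst (t ℕ.* 2 ℕ.<_) (≡.sym s≡1+2t) (ℕ.n<1+n _) ,
                                      trans y≈1 (sym (trans (^-congʳ h (≡.sym s≡1+2t)) hˢ≈1))
    shift (ℕ.suc i , i+1<s , y≈hⁱ⁺¹) = i , ℕ.<-trans (ℕ.n<1+n i) i+1<s , y≈hⁱ⁺¹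

  LPR⇒trace : ∀ {a} → ∃ (LPR a) → ∃ λ i → i ℕ.< s × Coprime (ℕ.suc i) s × a ≈ trace (ℕ.suc i)
  LPR⇒trace {a} (γ , lpr@(root , _)) = from-power (root-of-unity⇒positive-power (proj₁ (proj₂ order′)))
    where
    γ′ : Carrier
    γ′ = a - γ
    order′ : HasOrder γ′ s
    order′ = LPR⇒conjugate-order lpr refl
    from-power : ∃ (λ i → i ℕ.< s × γ′ ≈ h ^ ℕ.suc i) → ∃ λ i → i ℕ.< s × Coprime (ℕ.suc i) s × a ≈ trace (ℕ.suc i)
    from-power (i , i<s , γ′≈hᴷ) = i , i<s , order-^⇒coprime K order[h] (order-cong γ′≈hᴷ order′) , a≈trace
      where
      K = ℕ.suc i
      γ≈-hˢ⁻ᴷ : γ ≈ - h ^ (s ∸ K)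
      γ≈-hˢ⁻ᴷ = begin
        γ                          ≈⟨ *-identityʳ γ ⟨
        γ * 1#                     ≈⟨ *-congˡ (trans (*-congʳ γ′≈hᴷ) (hᵏhˢ⁻ᵏ≈1 i<s)) ⟨
        γ * (γ′ * h ^ (s ∸ K))     ≈⟨ *-assoc γ γ′ (h ^ (s ∸ K)) ⟨
        γ * γ′ * h ^ (s ∸ K)       ≈⟨ *-congʳ (root⇒γ[a-γ]≈-1 root) ⟩
        - 1# * h ^ (s ∸ K)         ≈⟨ -1*x≈-x (h ^ (s ∸ K)) ⟩
        - h ^ (s ∸ K)              ∎
      a≈trace : a ≈ trace K
      a≈trace = begin
        a                          ≈⟨ x+[y-x]≈y γ a ⟨
        γ + γ′                     ≈⟨ +-cong γ≈-hˢ⁻ᴷ γ′≈hᴷ ⟩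
        - h ^ (s ∸ K) + h ^ K      ≈⟨ +-comm (- h ^ (s ∸ K)) (h ^ K) ⟩
        trace K                    ∎

  totatives : List ℕ
  totatives = filter (λ k → gcd k s ℕ.≟ 1) (map ℕ.suc (upTo s))

  traces : List Carrier
  traces = map trace totatives

  traces-distinct : AllPairs (λ a b → ¬ a ≈ b) traces
  traces-distinct = AllPairs.map⁺ (AllPairs.filter⁺ _ (AllPairs.map⁺ (AllPairs.applyUpTo⁺₁ _ s trace-injective)))

  LPR⇒∈traces : ∀ {a} → ∃ (LPR a) → Any (a ≈_) traces
  LPR⇒∈traces lpr = let i , i<s , K⊥s , a≈trace = LPR⇒trace lpr in
    Any.map⁺ (lose (∈-filter⁺ _ (∈-map⁺ ℕ.suc (∈-upTo⁺ i<s)) (Coprime.coprime⇒gcd≡1 K⊥s)) a≈trace)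

  ∈traces⇒LPR : ∀ {a} → Any (a ≈_) traces → ∃ (LPR a)
  ∈traces⇒LPR a∈traces =
    let k , k∈totatives , a≈trace = find (Any.map⁻ a∈traces)
        k∈1-s , gcd≡1 = ∈-filter⁻ _ k∈totatives
        i , i∈upTo , k≡1+i = ∈-map⁻ ℕ.suc k∈1-s
        γ , root , generates = trace-LPR (≡.subst (ℕ._≤ s) (≡.sym k≡1+i) (∈-upTo⁻ i∈upTo)) (Coprime.gcd≡1⇒coprime gcd≡1)
    in  γ , IsRoot-resp (sym a≈trace) refl root , generates

mainTheorem16 : ∀ {c ℓ} (F : FiniteField c ℓ) →
    let open FiniteField F
        open FieldNotions F
        s = q / 2
    in q % 4 ≡ 3 →
      (∀ a γ₁ γ₂ → IsRoot a γ₁ → HasOrder γ₁ s → γ₂ ≈ a + (- γ₁) → LPR a γ₂)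
      × (Σ (List Carrier) λ as →
           AllPairs (λ x y → ¬ (x ≈ y)) as
           × length as ≡ φ s
           × (∀ a → ((∃ λ γ → LPR a γ) → Any (a ≈_) as) × (Any (a ≈_) as → ∃ λ γ → LPR a γ)))
      × (∀ a γ γ′ → LPR a γ → LPR a γ′ → γ ≈ γ′)
      × (∀ a γ γ′ → LPR a γ → γ′ ≈ a + (- γ) → HasOrder γ′ s)
      × (∀ a γ γ′ → LPR a γ → LPR a γ′ → ¬ (γ ≈ γ′) → ⊥)
mainTheorem16 F q≡3[4] =
    (λ _ _ _ → conjugate-of-order-s-is-LPR)
  , (traces , traces-distinct , length-map trace totatives , λ _ → LPR⇒∈traces , ∈traces⇒LPR)
  , (λ _ _ _ → LPR-unique)
  , (λ _ _ _ → LPR⇒conjugate-order)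
  , (λ _ _ _ lpr lpr′ γ≉γ′ → γ≉γ′ (LPR-unique lpr lpr′))
  where open LucasPrimitiveRoots F q≡3[4]
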